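{- For any finite field $F$ and positive integer $n$, if $\operatorname{char}(F)\neq 2$, then the unit graph $\Gamma'(M_n(F))$ is not well-covered.
   Context: $M_n(F)$ is the ring of $n\times n$ matrices over $F$. The unit graph $\Gamma'(S)$ of a ring $S$ has vertex set $S$, two distinct vertices $x,y$ adjacent iff $x+y$ is a unit of $S$. A graph is well-covered if all its maximal independent sets have the same size. -}

module Defs where

open import Level using (Level; _⊔_) renaming (suc to lsuc)
open import Data.Nat using (ℕ; zero; suc)
open import Data.Fin using (Fin; zero; suc)
open import Data.Fin.Properties using () renaming (_≟_ to _≟ᶠ_)
open import Data.List using (List; length)
open import Data.Product using (Σ; ∃; _×_; _,_)
open import Relation.Nullary using (¬_; yes; no)
open import Relation.Binary using (Rel; Setoid)
open import Relation.Binary.PropositionalEquality using (_≡_)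
open import Algebra.Bundles using (CommutativeRing; Ring)
import Data.List.Membership.Setoid as SetoidMembership
import Data.List.Relation.Unary.Unique.Setoid as SetoidUnique

record Field (c ℓ : Level) : Set (lsuc (c ⊔ ℓ)) where
  field
    commutativeRing : CommutativeRing c ℓ
  open CommutativeRing commutativeRing public
  field
    1≉0     : ¬ (1# ≈ 0#)
    inverse : ∀ x → ¬ (x ≈ 0#) → ∃ λ y → x * y ≈ 1#

Finite : ∀ {c ℓ} → Setoid c ℓ → Set (c ⊔ ℓ)
Finite S = Σ (List Carrier) λ xs → ∀ x → x ∈ xs
  where
  open Setoid S using (Carrier)
  open SetoidMembership S using (_∈_)

module MatrixRing {c ℓ} (R : Ring c ℓ) where
  open Ring R using (Carrier; _≈_; _+_; _*_; 0#; 1#; refl; sym; trans)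

  Matrix : ℕ → Set c
  Matrix n = Fin n → Fin n → Carrier

  ∑ : ∀ {n} → (Fin n → Carrier) → Carrier
  ∑ {zero}  f = 0#
  ∑ {suc n} f = f zero + ∑ (λ i → f (suc i))

  _≈ᴹ_ : ∀ {n} → Matrix n → Matrix n → Set ℓ
  A ≈ᴹ B = ∀ i j → A i j ≈ B i j

  _+ᴹ_ : ∀ {n} → Matrix n → Matrix n → Matrix n
  (A +ᴹ B) i j = A i j + B i j

  _*ᴹ_ : ∀ {n} → Matrix n → Matrix n → Matrix n
  (A *ᴹ B) i j = ∑ (λ k → A i k * B k j)

  1ᴹ : ∀ {n} → Matrix n
  1ᴹ i j with i ≟ᶠ j
  ... | yes _ = 1#
  ... | no  _ = 0#

  matrixSetoid : ℕ → Setoid c ℓ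
  matrixSetoid n = record
    { Carrier = Matrix n
    ; _≈_ = _≈ᴹ_
    ; isEquivalence = record
      { refl  = λ i j → refl
      ; sym   = λ p i j → sym (p i j)
      ; trans = λ p q i j → trans (p i j) (q i j)
      }
    }

  IsUnitᴹ : ∀ {n} → Matrix n → Set (c ⊔ ℓ)
  IsUnitᴹ A = ∃ λ B → ((A *ᴹ B) ≈ᴹ 1ᴹ) × ((B *ᴹ A) ≈ᴹ 1ᴹ)

-- Simple graphs on a setoid of vertices, given by an adjacency relation.
-- Finite vertex sets are lists without duplicates (up to ≈).

module Graphs {c ℓ a} (S : Setoid c ℓ) (Adj : Rel (Setoid.Carrier S) a) where
  open Setoid S
  open SetoidMembership S using (_∈_)
  open SetoidUnique S using (Unique)

  _⊆ˢ_ : List Carrier → List Carrier → Set (c ⊔ ℓ)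
  I ⊆ˢ J = ∀ {x} → x ∈ I → x ∈ J

  Independent : List Carrier → Set (c ⊔ ℓ ⊔ a)
  Independent I = Unique I × (∀ {x y} → x ∈ I → y ∈ I → ¬ (x ≈ y) → ¬ Adj x y)

  MaximalIndependent : List Carrier → Set (c ⊔ ℓ ⊔ a)
  MaximalIndependent I =
    Independent I × (∀ J → Independent J → I ⊆ˢ J → J ⊆ˢ I)

  WellCovered : Set (c ⊔ ℓ ⊔ a)
  WellCovered = ∀ I J → MaximalIndependent I → MaximalIndependent J →
                length I ≡ length J

module _ {c ℓ} (F : Field c ℓ) where
  open Field F using (ring)
  open MatrixRing ring

  UnitGraphAdj : ∀ n → Rel (Matrix n) (c ⊔ ℓ)
  UnitGraphAdj n A B = IsUnitᴹ (A +ᴹ B)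

  UnitGraphMatWellCovered : ℕ → Set (c ⊔ ℓ)
  UnitGraphMatWellCovered n = Graphs.WellCovered (matrixSetoid n) (UnitGraphAdj n)

CharNot2 : ∀ {c ℓ} → Field c ℓ → Set ℓ
CharNot2 F = ¬ (1# + 1# ≈ 0#)
  where open Field F

FiniteField : ∀ {c ℓ} → Field c ℓ → Set (c ⊔ ℓ)
FiniteField F = Finite (Field.setoid F)

{-# OPTIONS --safe #-}
module Submission where

open import Defs
open import Level using (Level)
open import Algebra.Bundles using (CommutativeRing)
open import Data.Nat as ℕ using (ℕ; zero; suc; _^_; _≤_; z≤n; s≤s)
import Data.Nat.Properties as ℕ
open import Data.Integer as ℤ using (ℤ; +_; -[1+_]; _⊖_; sign; ∣_∣; _◃_; 0ℤ; 1ℤ)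
import Data.Integer.Properties as ℤ
open import Data.Sign as Sign using (Sign)
open import Data.Fin using (Fin; zero; suc)
import Data.Fin.Properties as Fin
open import Data.List using (List; []; _∷_; map; length; cartesianProductWith)
import Data.List.Properties as List
open import Data.List.Relation.Unary.Any as Any using (here; there; _─_)
open import Data.List.Relation.Unary.All using (All; []; _∷_; lookupAny; tabulateₛ)
open import Data.List.Relation.Unary.AllPairs using ([]; _∷_)
open import Data.Maybe using (Maybe) renaming (map to mapMaybe)
open import Data.Product using (∃; _×_; _,_; proj₁; proj₂)
open import Data.Sum using (_⊎_; inj₁; inj₂)
open import Data.Vec.Functional as Vector using (Vector)
open import Function using (_∘_)
open import Relation.Nullary using (¬_; Dec; yes; no; contradiction; ¬¬-excluded-middle)
open import Relation.Nullary.Negation using (¬¬-map)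
open import Relation.Nullary.Decidable using (map′; _×-dec_; _⊎-dec_)
open import Relation.Binary using (Setoid; Rel; Decidable; _Respects₂_)
open import Relation.Binary.Consequences using (dec⇒weaklyDec)
open import Relation.Binary.PropositionalEquality as ≡ using (_≡_)
import Algebra.Solver.Ring.AlmostCommutativeRing as ACR
import Algebra.Solver.Ring
import Relation.Binary.Reasoning.Setoid as SetoidReasoning
import Data.List.Membership.Setoid as SetoidMembership
import Data.List.Membership.Setoid.Properties as Membership
import Data.List.Relation.Unary.Unique.Setoid as SetoidUnique
import Data.List.Relation.Unary.Unique.Setoid.Properties as Unique
import Data.Vec.Functional.Relation.Binary.Equality.Setoid as VectorEquality

-- The 2ⁿ diagonal matrices with entries ±1 form a maximal independent set of Γ'(Mₙ(F)).
-- Two distinct ones differ in sign at some i, so their sum has a zero row. Conversely,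
-- for every matrix B some sign vector v makes diag v + B invertible: choose the first
-- sign so that it does not cancel B₀₀ (one of ±1 works since 1 ≠ -1) and recurse on
-- the Schur complement. For n ≥ 2, the 3ⁿ matrices with zero top row and all other
-- rows equal to one vector in {0, 1, -1}ⁿ are pairwise non-adjacent, so some maximal
-- independent set has at least 3ⁿ > 2ⁿ elements; for n = 1, {0} is maximal
-- independent. As the claim is a negation, equality in the finite field may be
-- assumed decidable.

-- Ring solver for any commutative ring, with ℤ coefficients so that cancellations
-- such as x - x ≈ 0# are visible to the normaliser. The multiples _×′_ are the
-- TC-optimised ones, for which ⟦ 1ℤ ⟧ℤ is definitionally 1#.
module IntegerCoefficientSolver {c ℓ} (R : CommutativeRing c ℓ) where
  open CommutativeRing R
  open import Algebra.Properties.Ring ring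
  open import Algebra.Properties.Semiring.Mult.TCOptimised semiring renaming (_×_ to _×′_)
  open SetoidReasoning setoid

  ⟦_⟧ℤ : ℤ → Carrier
  ⟦ + n ⟧ℤ      = n ×′ 1#
  ⟦ -[1+ n ] ⟧ℤ = - (suc n ×′ 1#)

  ⟦-⟧ℤ : ∀ i → ⟦ ℤ.- i ⟧ℤ ≈ - ⟦ i ⟧ℤ
  ⟦-⟧ℤ -[1+ n ]    = sym (-‿involutive _)
  ⟦-⟧ℤ (+ zero)    = sym -0#≈0#
  ⟦-⟧ℤ (+ (suc n)) = refl

  ⟦⊖⟧ℤ : ∀ m n → ⟦ m ⊖ n ⟧ℤ ≈ m ×′ 1# - n ×′ 1#
  ⟦⊖⟧ℤ m       zero    = sym (trans (+-congˡ -0#≈0#) (+-identityʳ _))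
  ⟦⊖⟧ℤ zero    (suc n) = sym (+-identityˡ _)
  ⟦⊖⟧ℤ (suc m) (suc n) = begin
    ⟦ suc m ⊖ suc n ⟧ℤ                 ≡⟨ ≡.cong ⟦_⟧ℤ (ℤ.[1+m]⊖[1+n]≡m⊖n m n) ⟩
    ⟦ m ⊖ n ⟧ℤ                         ≈⟨ ⟦⊖⟧ℤ m n ⟩
    m ×′ 1# - n ×′ 1#                  ≈⟨ +-congʳ (sym (xyx⁻¹≈y 1# _)) ⟩
    1# + m ×′ 1# - 1# - n ×′ 1#        ≈⟨ +-assoc _ _ _ ⟩
    1# + m ×′ 1# + (- 1# - n ×′ 1#)    ≈⟨ +-cong (sym (1+× m 1#)) (-‿+-comm 1# _) ⟩
    suc m ×′ 1# - (1# + n ×′ 1#)       ≈⟨ +-congˡ (-‿cong (1+× n 1#)) ⟨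
    suc m ×′ 1# - suc n ×′ 1#          ∎

  ⟦+⟧ℤ : ∀ i j → ⟦ i ℤ.+ j ⟧ℤ ≈ ⟦ i ⟧ℤ + ⟦ j ⟧ℤ
  ⟦+⟧ℤ (+ m)    (+ n)    = ×-homo-+ 1# m n
  ⟦+⟧ℤ (+ m)    -[1+ n ] = ⟦⊖⟧ℤ m (suc n)
  ⟦+⟧ℤ -[1+ m ] (+ n)    = trans (⟦⊖⟧ℤ n (suc m)) (+-comm _ _)
  ⟦+⟧ℤ -[1+ m ] -[1+ n ] = begin
    - (suc (suc (m ℕ.+ n)) ×′ 1#)       ≡⟨ ≡.cong (λ k → - (suc k ×′ 1#)) (ℕ.+-suc m n) ⟨
    - ((suc m ℕ.+ suc n) ×′ 1#)         ≈⟨ -‿cong (×-homo-+ 1# (suc m) (suc n)) ⟩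
    - (suc m ×′ 1# + suc n ×′ 1#)       ≈⟨ -‿+-comm _ _ ⟨
    - (suc m ×′ 1#) + - (suc n ×′ 1#)   ∎

  signed : Sign → Carrier → Carrier
  signed Sign.+ x = x
  signed Sign.- x = - x

  signed-cong : ∀ s {x y} → x ≈ y → signed s x ≈ signed s y
  signed-cong Sign.+ x≈y = x≈y
  signed-cong Sign.- x≈y = -‿cong x≈y

  signed-* : ∀ s t x y → signed (s Sign.* t) (x * y) ≈ signed s x * signed t y
  signed-* Sign.+ Sign.+ x y = refl
  signed-* Sign.+ Sign.- x y = -‿distribʳ-* x y
  signed-* Sign.- Sign.+ x y = -‿distribˡ-* x y
  signed-* Sign.- Sign.- x y = begin
    x * y          ≈⟨ -‿involutive _ ⟨
    - - (x * y)    ≈⟨ -‿cong (-‿distribˡ-* x y) ⟩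
    - (- x * y)    ≈⟨ -‿distribʳ-* (- x) y ⟩
    - x * - y      ∎

  ⟦◃⟧ℤ : ∀ s n → ⟦ s ◃ n ⟧ℤ ≈ signed s (n ×′ 1#)
  ⟦◃⟧ℤ Sign.+ n = reflexive (≡.cong ⟦_⟧ℤ (ℤ.+◃n≡+n n))
  ⟦◃⟧ℤ Sign.- n = trans (reflexive (≡.cong ⟦_⟧ℤ (ℤ.-◃n≡-n n))) (⟦-⟧ℤ (+ n))

  ⟦⟧ℤ-signAbs : ∀ i → signed (sign i) (∣ i ∣ ×′ 1#) ≈ ⟦ i ⟧ℤ
  ⟦⟧ℤ-signAbs (+ n)    = refl
  ⟦⟧ℤ-signAbs -[1+ n ] = refl

  ⟦*⟧ℤ : ∀ i j → ⟦ i ℤ.* j ⟧ℤ ≈ ⟦ i ⟧ℤ * ⟦ j ⟧ℤ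
  ⟦*⟧ℤ i j = begin
    ⟦ s ◃ (∣ i ∣ ℕ.* ∣ j ∣) ⟧ℤ                                   ≈⟨ ⟦◃⟧ℤ s (∣ i ∣ ℕ.* ∣ j ∣) ⟩
    signed s ((∣ i ∣ ℕ.* ∣ j ∣) ×′ 1#)                             ≈⟨ signed-cong s (×1-homo-* ∣ i ∣ ∣ j ∣) ⟩
    signed s (∣ i ∣ ×′ 1# * ∣ j ∣ ×′ 1#)                           ≈⟨ signed-* (sign i) (sign j) _ _ ⟩
    signed (sign i) (∣ i ∣ ×′ 1#) * signed (sign j) (∣ j ∣ ×′ 1#)  ≈⟨ *-cong (⟦⟧ℤ-signAbs i) (⟦⟧ℤ-signAbs j) ⟩
    ⟦ i ⟧ℤ * ⟦ j ⟧ℤ                                               ∎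
    where
    s : Sign
    s = sign i Sign.* sign j

  ⟦⟧ℤ-morphism : ACR._-Raw-AlmostCommutative⟶_ ℤ.+-*-rawRing (ACR.fromCommutativeRing R)
  ⟦⟧ℤ-morphism = record
    { ⟦_⟧    = ⟦_⟧ℤ
    ; +-homo = ⟦+⟧ℤ
    ; *-homo = ⟦*⟧ℤ
    ; -‿homo = ⟦-⟧ℤ
    ; 0-homo = refl
    ; 1-homo = refl
    }

  ⟦⟧ℤ-≟ : ∀ i j → Maybe (⟦ i ⟧ℤ ≈ ⟦ j ⟧ℤ)
  ⟦⟧ℤ-≟ i j = mapMaybe (reflexive ∘ ≡.cong ⟦_⟧ℤ) (dec⇒weaklyDec ℤ._≟_ i j)

  open Algebra.Solver.Ring ℤ.+-*-rawRing (ACR.fromCommutativeRing R) ⟦⟧ℤ-morphism ⟦⟧ℤ-≟ public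

module MatrixAlgebra {ℓ₁ ℓ₂} (R : CommutativeRing ℓ₁ ℓ₂) where
  open CommutativeRing R hiding (zero)
  open MatrixRing ring
  open IntegerCoefficientSolver R using (solve; _:=_; _:+_; _:*_; :-_; _:-_; con)
  open import Algebra.Properties.CommutativeSemigroup +-commutativeSemigroup using (interchange)
  open VectorEquality setoid using (_≋_)
  open SetoidReasoning setoid

  module ≈ᴹ {n} = Setoid (matrixSetoid n)

  ∑-cong : ∀ {n} {f g : Vector Carrier n} → f ≋ g → ∑ f ≈ ∑ g
  ∑-cong {zero}  f≋g = refl
  ∑-cong {suc n} f≋g = +-cong (f≋g zero) (∑-cong (λ i → f≋g (suc i)))

  ∑-zero : ∀ n → ∑ {n} (λ _ → 0#) ≈ 0#
  ∑-zero zero    = refl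
  ∑-zero (suc n) = trans (+-identityˡ _) (∑-zero n)

  ∑-distrib-+ : ∀ {n} (f g : Vector Carrier n) → ∑ (λ i → f i + g i) ≈ ∑ f + ∑ g
  ∑-distrib-+ {zero}  f g = sym (+-identityˡ 0#)
  ∑-distrib-+ {suc n} f g =
    trans (+-congˡ (∑-distrib-+ (λ i → f (suc i)) (λ i → g (suc i)))) (interchange _ _ _ _)

  *-distribˡ-∑ : ∀ {n} x (f : Vector Carrier n) → x * ∑ f ≈ ∑ (λ i → x * f i)
  *-distribˡ-∑ {zero}  x f = zeroʳ x
  *-distribˡ-∑ {suc n} x f = trans (distribˡ _ _ _) (+-congˡ (*-distribˡ-∑ x (λ i → f (suc i))))

  *-distribʳ-∑ : ∀ {n} x (f : Vector Carrier n) → ∑ f * x ≈ ∑ (λ i → f i * x)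
  *-distribʳ-∑ {zero}  x f = zeroˡ x
  *-distribʳ-∑ {suc n} x f = trans (distribʳ _ _ _) (+-congˡ (*-distribʳ-∑ x (λ i → f (suc i))))

  ∑-comm : ∀ {m n} (f : Fin m → Fin n → Carrier) →
           ∑ (λ i → ∑ (λ j → f i j)) ≈ ∑ (λ j → ∑ (λ i → f i j))
  ∑-comm {zero}  {n} f = sym (∑-zero n)
  ∑-comm {suc m} {n} f = begin
    ∑ (f zero) + ∑ (λ i → ∑ (f (suc i)))               ≈⟨ +-congˡ (∑-comm (λ i → f (suc i))) ⟩
    ∑ (f zero) + ∑ (λ j → ∑ (λ i → f (suc i) j))       ≈⟨ ∑-distrib-+ (f zero) _ ⟨
    ∑ (λ j → f zero j + ∑ (λ i → f (suc i) j))         ∎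

  1ᴹ-diag : ∀ {n} (i : Fin n) → 1ᴹ i i ≡ 1#
  1ᴹ-diag i with i Fin.≟ i
  ... | yes _  = ≡.refl
  ... | no i≢i = contradiction ≡.refl i≢i

  1ᴹ-suc : ∀ {n} (i j : Fin n) → 1ᴹ (suc i) (suc j) ≡ 1ᴹ i j
  1ᴹ-suc i j with i Fin.≟ j
  ... | yes _ = ≡.refl
  ... | no  _ = ≡.refl

  _*ᴹᵛ_ : ∀ {n} → Matrix n → Vector Carrier n → Vector Carrier n
  (M *ᴹᵛ v) i = ∑ (λ j → M i j * v j)

  _*ᵛᴹ_ : ∀ {n} → Vector Carrier n → Matrix n → Vector Carrier n
  (u *ᵛᴹ M) j = ∑ (λ i → u i * M i j)

  _·_ : ∀ {n} → Vector Carrier n → Vector Carrier n → Carrier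
  u · v = ∑ (λ i → u i * v i)

  ·-assoc : ∀ {n} (u : Vector Carrier n) M v → (u *ᵛᴹ M) · v ≈ u · (M *ᴹᵛ v)
  ·-assoc {n} u M v = begin
    ∑ (λ j → ∑ (λ i → u i * M i j) * v j)   ≈⟨ ∑-cong {n} (λ j → *-distribʳ-∑ (v j) (λ i → u i * M i j)) ⟩
    ∑ (λ j → ∑ (λ i → u i * M i j * v j))   ≈⟨ ∑-comm (λ j i → u i * M i j * v j) ⟩
    ∑ (λ i → ∑ (λ j → u i * M i j * v j))   ≈⟨ ∑-cong {n} (λ i → ∑-cong {n} (λ j → *-assoc _ _ _)) ⟩
    ∑ (λ i → ∑ (λ j → u i * (M i j * v j))) ≈⟨ ∑-cong {n} (λ i → *-distribˡ-∑ (u i) (λ j → M i j * v j)) ⟨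
    ∑ (λ i → u i * ∑ (λ j → M i j * v j))   ∎

  *ᴹᵛ-assoc : ∀ {n} (M N : Matrix n) v → M *ᴹᵛ (N *ᴹᵛ v) ≋ (M *ᴹ N) *ᴹᵛ v
  *ᴹᵛ-assoc M N v i = sym (·-assoc (M i) N v)

  *ᵛᴹ-assoc : ∀ {n} (u : Vector Carrier n) M N → (u *ᵛᴹ M) *ᵛᴹ N ≋ u *ᵛᴹ (M *ᴹ N)
  *ᵛᴹ-assoc u M N j = ·-assoc u M (λ k → N k j)

  ·-*ˡ : ∀ {n} x (u v : Vector Carrier n) → (λ i → x * u i) · v ≈ x * (u · v)
  ·-*ˡ {n} x u v = trans (∑-cong {n} (λ i → *-assoc _ _ _)) (sym (*-distribˡ-∑ x (λ i → u i * v i)))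

  ·-*ʳ : ∀ {n} x (u v : Vector Carrier n) → u · (λ i → v i * x) ≈ (u · v) * x
  ·-*ʳ {n} x u v = trans (∑-cong {n} (λ i → sym (*-assoc _ _ _))) (sym (*-distribʳ-∑ x (λ i → u i * v i)))

  *ᴹᵛ-identityˡ : ∀ {n} (v : Vector Carrier n) → 1ᴹ *ᴹᵛ v ≋ v
  *ᴹᵛ-identityˡ {suc n} v zero =
    trans (+-cong (*-identityˡ _) (trans (∑-cong {n} (λ j → zeroˡ _)) (∑-zero n))) (+-identityʳ _)
  *ᴹᵛ-identityˡ {suc n} v (suc i) = begin
    0# * v zero + ∑ (λ j → 1ᴹ (suc i) (suc j) * v (suc j))
      ≈⟨ +-cong (zeroˡ _) (∑-cong {n} (λ j → *-congʳ (reflexive (1ᴹ-suc i j)))) ⟩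
    0# + (1ᴹ *ᴹᵛ (λ j → v (suc j))) i  ≈⟨ +-identityˡ _ ⟩
    (1ᴹ *ᴹᵛ (λ j → v (suc j))) i        ≈⟨ *ᴹᵛ-identityˡ (λ j → v (suc j)) i ⟩
    v (suc i)                            ∎

  *ᵛᴹ-identityʳ : ∀ {n} (u : Vector Carrier n) → u *ᵛᴹ 1ᴹ ≋ u
  *ᵛᴹ-identityʳ {suc n} u zero =
    trans (+-cong (*-identityʳ _) (trans (∑-cong {n} (λ i → zeroʳ _)) (∑-zero n))) (+-identityʳ _)
  *ᵛᴹ-identityʳ {suc n} u (suc j) = begin
    u zero * 0# + ∑ (λ i → u (suc i) * 1ᴹ (suc i) (suc j))
      ≈⟨ +-cong (zeroʳ _) (∑-cong {n} (λ i → *-congˡ (reflexive (1ᴹ-suc i j)))) ⟩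
    0# + ((λ i → u (suc i)) *ᵛᴹ 1ᴹ) j  ≈⟨ +-identityˡ _ ⟩
    ((λ i → u (suc i)) *ᵛᴹ 1ᴹ) j        ≈⟨ *ᵛᴹ-identityʳ (λ i → u (suc i)) j ⟩
    u (suc j)                            ∎

  *ᴹ-cong : ∀ {n} {A A′ B B′ : Matrix n} → A ≈ᴹ A′ → B ≈ᴹ B′ → (A *ᴹ B) ≈ᴹ (A′ *ᴹ B′)
  *ᴹ-cong A≈A′ B≈B′ i j = ∑-cong (λ k → *-cong (A≈A′ i k) (B≈B′ k j))

  IsUnitᴹ-resp : ∀ {n} {A B : Matrix n} → A ≈ᴹ B → IsUnitᴹ A → IsUnitᴹ B
  IsUnitᴹ-resp A≈B (C , AC≈1 , CA≈1) =
    C , ≈ᴹ.trans (*ᴹ-cong (≈ᴹ.sym A≈B) ≈ᴹ.refl) AC≈1 , ≈ᴹ.trans (*ᴹ-cong ≈ᴹ.refl (≈ᴹ.sym A≈B)) CA≈1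

  inverse-resp : ∀ {n} {A B B′ : Matrix n} → B ≈ᴹ B′ →
                 (A *ᴹ B) ≈ᴹ 1ᴹ × (B *ᴹ A) ≈ᴹ 1ᴹ → (A *ᴹ B′) ≈ᴹ 1ᴹ × (B′ *ᴹ A) ≈ᴹ 1ᴹ
  inverse-resp B≈B′ (AB≈1 , BA≈1) =
    ≈ᴹ.trans (*ᴹ-cong ≈ᴹ.refl (≈ᴹ.sym B≈B′)) AB≈1 , ≈ᴹ.trans (*ᴹ-cong (≈ᴹ.sym B≈B′) ≈ᴹ.refl) BA≈1

  zeroRow⇒¬IsUnitᴹ : ¬ 1# ≈ 0# → ∀ {n} (A : Matrix n) i → (∀ j → A i j ≈ 0#) → ¬ IsUnitᴹ A
  zeroRow⇒¬IsUnitᴹ 1≉0 {n} A i Aᵢ≈0 (B , AB≈1 , _) = 1≉0 (begin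
    1#                         ≡⟨ 1ᴹ-diag i ⟨
    1ᴹ i i                     ≈⟨ AB≈1 i i ⟨
    ∑ (λ k → A i k * B k i)    ≈⟨ ∑-cong (λ k → trans (*-congʳ (Aᵢ≈0 k)) (zeroˡ _)) ⟩
    ∑ {n} (λ _ → 0#)           ≈⟨ ∑-zero n ⟩
    0#                         ∎)

  schurComplement : ∀ {m} → Matrix (suc m) → Carrier → Matrix m
  schurComplement X a′ k l = X (suc k) (suc l) - X (suc k) zero * (a′ * X zero (suc l))

  module SchurInverse {m} (X : Matrix (suc m)) {a′ : Carrier} (aa′≈1 : X zero zero * a′ ≈ 1#)
                      {W : Matrix m} (SW≈1 : (schurComplement X a′ *ᴹ W) ≈ᴹ 1ᴹ)
                      (WS≈1 : (W *ᴹ schurComplement X a′) ≈ᴹ 1ᴹ) where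
    a : Carrier
    a = X zero zero
    r c : Vector Carrier m
    r l = X zero (suc l)
    c k = X (suc k) zero
    D S : Matrix m
    D k l = X (suc k) (suc l)
    S = schurComplement X a′

    Wc rW : Vector Carrier m
    Wc = W *ᴹᵛ c
    rW = r *ᵛᴹ W
    t : Carrier
    t = r · Wc

    -- The block inverse of X = [[a, r], [c, D]] via its Schur complement S = D - c a′ r = W⁻¹.
    inverse : Matrix (suc m)
    inverse zero    zero    = a′ + a′ * t * a′
    inverse zero    (suc l) = - a′ * rW l
    inverse (suc k) zero    = Wc k * - a′
    inverse (suc k) (suc l) = W k l

    -- Each entry of a product with the inverse matches 1ᴹ only modulo a a′ - 1, so the
    -- solver proves it in the form  entry ≈ target + (a a′ - 1) z.
    pivot-cancel : ∀ y z → y + (a * a′ - 1#) * z ≈ y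
    pivot-cancel y z = begin
      y + (a * a′ - 1#) * z  ≈⟨ +-congˡ (*-congʳ (+-congʳ aa′≈1)) ⟩
      y + (1# - 1#) * z      ≈⟨ solve 2 (λ y z → y :+ (con 1ℤ :- con 1ℤ) :* z := y) refl y z ⟩
      y                      ∎

    minor≈ : ∀ k l → D k l ≈ S k l + c k * (a′ * r l)
    minor≈ k l = solve 2 (λ d y → d := (d :- y) :+ y) refl (D k l) (c k * (a′ * r l))

    minor-*ᴹᵛ : ∀ (w : Vector Carrier m) k → (D *ᴹᵛ w) k ≈ (S *ᴹᵛ w) k + c k * (a′ * (r · w))
    minor-*ᴹᵛ w k = begin
      ∑ (λ j → D k j * w j)
        ≈⟨ ∑-cong {m} (λ j → trans (*-congʳ (minor≈ k j)) (distribʳ _ _ _)) ⟩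
      ∑ (λ j → S k j * w j + c k * (a′ * r j) * w j)
        ≈⟨ ∑-distrib-+ (λ j → S k j * w j) _ ⟩
      (S *ᴹᵛ w) k + (λ j → c k * (a′ * r j)) · w
        ≈⟨ +-congˡ (trans (·-*ˡ (c k) (λ j → a′ * r j) w) (*-congˡ (·-*ˡ a′ r w))) ⟩
      (S *ᴹᵛ w) k + c k * (a′ * (r · w))
        ∎

    *ᵛᴹ-minor : ∀ (w : Vector Carrier m) l → (w *ᵛᴹ D) l ≈ (w *ᵛᴹ S) l + (w · c) * (a′ * r l)
    *ᵛᴹ-minor w l = begin
      ∑ (λ k → w k * D k l)
        ≈⟨ ∑-cong {m} (λ k → trans (*-congˡ (minor≈ k l)) (distribˡ _ _ _)) ⟩
      ∑ (λ k → w k * S k l + w k * (c k * (a′ * r l)))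
        ≈⟨ ∑-distrib-+ (λ k → w k * S k l) _ ⟩
      (w *ᵛᴹ S) l + w · (λ k → c k * (a′ * r l))
        ≈⟨ +-congˡ (·-*ʳ (a′ * r l) w c) ⟩
      (w *ᵛᴹ S) l + (w · c) * (a′ * r l)
        ∎

    minor-*ᴹᵛ-Wc : ∀ k → (D *ᴹᵛ Wc) k ≈ c k + c k * (a′ * t)
    minor-*ᴹᵛ-Wc k = begin
      (D *ᴹᵛ Wc) k                          ≈⟨ minor-*ᴹᵛ Wc k ⟩
      (S *ᴹᵛ (W *ᴹᵛ c)) k + c k * (a′ * t)  ≈⟨ +-congʳ (*ᴹᵛ-assoc S W c k) ⟩
      ((S *ᴹ W) *ᴹᵛ c) k + c k * (a′ * t)   ≈⟨ +-congʳ (∑-cong {m} (λ j → *-congʳ (SW≈1 k j))) ⟩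
      (1ᴹ *ᴹᵛ c) k + c k * (a′ * t)         ≈⟨ +-congʳ (*ᴹᵛ-identityˡ c k) ⟩
      c k + c k * (a′ * t)                  ∎

    rW-*ᵛᴹ-minor : ∀ l → (rW *ᵛᴹ D) l ≈ r l + t * (a′ * r l)
    rW-*ᵛᴹ-minor l = begin
      (rW *ᵛᴹ D) l                                  ≈⟨ *ᵛᴹ-minor rW l ⟩
      ((r *ᵛᴹ W) *ᵛᴹ S) l + (rW · c) * (a′ * r l)   ≈⟨ +-cong (*ᵛᴹ-assoc r W S l) (*-congʳ (·-assoc r W c)) ⟩
      (r *ᵛᴹ (W *ᴹ S)) l + t * (a′ * r l)           ≈⟨ +-congʳ (∑-cong {m} (λ k → *-congˡ (WS≈1 k l))) ⟩
      (r *ᵛᴹ 1ᴹ) l + t * (a′ * r l)                 ≈⟨ +-congʳ (*ᵛᴹ-identityʳ r l) ⟩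
      r l + t * (a′ * r l)                          ∎

    X*inverse≈1 : (X *ᴹ inverse) ≈ᴹ 1ᴹ
    X*inverse≈1 zero zero = begin
      a * (a′ + a′ * t * a′) + r · (λ k → Wc k * - a′)  ≈⟨ +-congˡ (·-*ʳ (- a′) r Wc) ⟩
      a * (a′ + a′ * t * a′) + t * - a′
        ≈⟨ solve 3 (λ a a′ t → a :* (a′ :+ a′ :* t :* a′) :+ t :* :- a′
                             := con 1ℤ :+ (a :* a′ :- con 1ℤ) :* (con 1ℤ :+ t :* a′)) refl a a′ t ⟩
      1# + (a * a′ - 1#) * (1# + t * a′)                ≈⟨ pivot-cancel _ _ ⟩
      1#                                                ∎
    X*inverse≈1 zero (suc l) = begin
      a * (- a′ * rW l) + rW l
        ≈⟨ solve 3 (λ a a′ v → a :* (:- a′ :* v) :+ v := con 0ℤ :+ (a :* a′ :- con 1ℤ) :* (:- v))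
                   refl a a′ (rW l) ⟩
      0# + (a * a′ - 1#) * - rW l  ≈⟨ pivot-cancel _ _ ⟩
      0#                           ∎
    X*inverse≈1 (suc k) zero = begin
      c k * (a′ + a′ * t * a′) + D k · (λ j → Wc j * - a′)      ≈⟨ +-congˡ (·-*ʳ (- a′) (D k) Wc) ⟩
      c k * (a′ + a′ * t * a′) + (D *ᴹᵛ Wc) k * - a′            ≈⟨ +-congˡ (*-congʳ (minor-*ᴹᵛ-Wc k)) ⟩
      c k * (a′ + a′ * t * a′) + (c k + c k * (a′ * t)) * - a′
        ≈⟨ solve 3 (λ x a′ t → x :* (a′ :+ a′ :* t :* a′) :+ (x :+ x :* (a′ :* t)) :* :- a′ := con 0ℤ)
                   refl (c k) a′ t ⟩
      0#                                                        ∎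
    X*inverse≈1 (suc k) (suc l) = begin
      c k * (- a′ * rW l) + (D *ᴹᵛ (λ j → W j l)) k              ≈⟨ +-congˡ (minor-*ᴹᵛ (λ j → W j l) k) ⟩
      c k * (- a′ * rW l) + ((S *ᴹ W) k l + c k * (a′ * rW l))   ≈⟨ +-congˡ (+-congʳ (SW≈1 k l)) ⟩
      c k * (- a′ * rW l) + (1ᴹ k l + c k * (a′ * rW l))
        ≈⟨ solve 4 (λ x a′ v δ → x :* (:- a′ :* v) :+ (δ :+ x :* (a′ :* v)) := δ) refl (c k) a′ (rW l) (1ᴹ k l) ⟩
      1ᴹ k l                                                     ≡⟨ 1ᴹ-suc k l ⟨
      1ᴹ (suc k) (suc l)                                         ∎

    inverse*X≈1 : (inverse *ᴹ X) ≈ᴹ 1ᴹ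
    inverse*X≈1 zero zero = begin
      (a′ + a′ * t * a′) * a + (λ k → - a′ * rW k) · c  ≈⟨ +-congˡ (·-*ˡ (- a′) rW c) ⟩
      (a′ + a′ * t * a′) * a + - a′ * (rW · c)          ≈⟨ +-congˡ (*-congˡ (·-assoc r W c)) ⟩
      (a′ + a′ * t * a′) * a + - a′ * t
        ≈⟨ solve 3 (λ a a′ t → (a′ :+ a′ :* t :* a′) :* a :+ :- a′ :* t
                             := con 1ℤ :+ (a :* a′ :- con 1ℤ) :* (con 1ℤ :+ a′ :* t)) refl a a′ t ⟩
      1# + (a * a′ - 1#) * (1# + a′ * t)                ≈⟨ pivot-cancel _ _ ⟩
      1#                                                ∎
    inverse*X≈1 zero (suc l) = begin
      (a′ + a′ * t * a′) * r l + (λ k → - a′ * rW k) · (λ k → D k l)  ≈⟨ +-congˡ (·-*ˡ (- a′) rW (λ k → D k l)) ⟩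
      (a′ + a′ * t * a′) * r l + - a′ * (rW *ᵛᴹ D) l                  ≈⟨ +-congˡ (*-congˡ (rW-*ᵛᴹ-minor l)) ⟩
      (a′ + a′ * t * a′) * r l + - a′ * (r l + t * (a′ * r l))
        ≈⟨ solve 3 (λ a′ t x → (a′ :+ a′ :* t :* a′) :* x :+ :- a′ :* (x :+ t :* (a′ :* x)) := con 0ℤ)
                   refl a′ t (r l) ⟩
      0#                                                              ∎
    inverse*X≈1 (suc k) zero = begin
      Wc k * - a′ * a + Wc k
        ≈⟨ solve 3 (λ a a′ u → u :* :- a′ :* a :+ u := con 0ℤ :+ (a :* a′ :- con 1ℤ) :* (:- u))
                   refl a a′ (Wc k) ⟩
      0# + (a * a′ - 1#) * - Wc k  ≈⟨ pivot-cancel _ _ ⟩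
      0#                           ∎
    inverse*X≈1 (suc k) (suc l) = begin
      Wc k * - a′ * r l + (W k *ᵛᴹ D) l                          ≈⟨ +-congˡ (*ᵛᴹ-minor (W k) l) ⟩
      Wc k * - a′ * r l + ((W *ᴹ S) k l + Wc k * (a′ * r l))     ≈⟨ +-congˡ (+-congʳ (WS≈1 k l)) ⟩
      Wc k * - a′ * r l + (1ᴹ k l + Wc k * (a′ * r l))
        ≈⟨ solve 4 (λ u a′ x δ → u :* :- a′ :* x :+ (δ :+ u :* (a′ :* x)) := δ) refl (Wc k) a′ (r l) (1ᴹ k l) ⟩
      1ᴹ k l                                                     ≡⟨ 1ᴹ-suc k l ⟨
      1ᴹ (suc k) (suc l)                                         ∎

  IsUnitᴹ-schurComplement : ∀ {m} (X : Matrix (suc m)) {a′} → X zero zero * a′ ≈ 1# →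
                            IsUnitᴹ (schurComplement X a′) → IsUnitᴹ X
  IsUnitᴹ-schurComplement X aa′≈1 (W , SW≈1 , WS≈1) = inverse , X*inverse≈1 , inverse*X≈1
    where open SchurInverse X aa′≈1 SW≈1 WS≈1

module SignDiagonals {ℓ₁ ℓ₂} (F : Field ℓ₁ ℓ₂) (_≟_ : Decidable (Field._≈_ F)) (1+1≉0 : CharNot2 F) where
  open Field F hiding (zero)
  open MatrixRing ring
  open MatrixAlgebra commutativeRing
  open IntegerCoefficientSolver commutativeRing using (solve; _:=_; _:+_; _:*_; :-_; _:-_; con)
  open SetoidMembership setoid using (_∈_)
  open SetoidUnique setoid using (Unique)
  open VectorEquality setoid using (_≋_)
  open SetoidReasoning setoid

  signs : List Carrier
  signs = 1# ∷ - 1# ∷ []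

  diag : ∀ {n} → Vector Carrier n → Matrix n
  diag v i j = v i * 1ᴹ i j

  sign-avoiding : ∀ b → ∃ λ s → s ∈ signs × ¬ s + b ≈ 0#
  sign-avoiding b with (1# + b) ≟ 0#
  ... | no 1+b≉0 = 1# , here refl , 1+b≉0
  ... | yes 1+b≈0 = - 1# , there (here refl) , λ -1+b≈0 → 1+1≉0 (begin
    1# + 1#                    ≈⟨ solve 1 (λ b → con 1ℤ :+ con 1ℤ := (con 1ℤ :+ b) :- (:- con 1ℤ :+ b)) refl b ⟩
    (1# + b) - (- 1# + b)      ≈⟨ +-cong 1+b≈0 (-‿cong -1+b≈0) ⟩
    0# - 0#                    ≈⟨ -‿inverseʳ 0# ⟩
    0#                         ∎)

  IsUnitᴹ-diag+ : ∀ {n} (B : Matrix n) → ∃ λ v → (∀ i → v i ∈ signs) × IsUnitᴹ (diag v +ᴹ B)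
  IsUnitᴹ-diag+ {zero}  B = (λ ()) , (λ ()) , (λ ()) , (λ ()) , (λ ())
  IsUnitᴹ-diag+ {suc m} B
    with s , s∈signs , s+b≉0 ← sign-avoiding (B zero zero)
    with a′ , sa′≈1 ← inverse (s * 1# + B zero zero) (λ e → s+b≉0 (trans (+-congʳ (sym (*-identityʳ s))) e))
    with v , v∈signs , unit ← IsUnitᴹ-diag+ (schurComplement B a′)
    = s Vector.∷ v , (λ { zero → s∈signs ; (suc i) → v∈signs i })
    , IsUnitᴹ-schurComplement (diag (s Vector.∷ v) +ᴹ B) sa′≈1 (IsUnitᴹ-resp (≈ᴹ.sym schur≈) unit)
    where
    schur≈ : schurComplement (diag (s Vector.∷ v) +ᴹ B) a′ ≈ᴹ (diag v +ᴹ schurComplement B a′)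
    schur≈ k l = begin
      (v k * 1ᴹ (suc k) (suc l) + d) - (v k * 0# + c) * (a′ * (s * 0# + r))
        ≈⟨ +-congʳ (+-congʳ (*-congˡ (reflexive (1ᴹ-suc k l)))) ⟩
      (v k * 1ᴹ k l + d) - (v k * 0# + c) * (a′ * (s * 0# + r))
        ≈⟨ solve 7 (λ x δ d s c a′ r → (x :* δ :+ d) :- (x :* con 0ℤ :+ c) :* (a′ :* (s :* con 0ℤ :+ r))
                                     := x :* δ :+ (d :- c :* (a′ :* r)))
                   refl (v k) (1ᴹ k l) d s c a′ r ⟩
      v k * 1ᴹ k l + (d - c * (a′ * r))
        ∎
      where
      d c r : Carrier
      d = B (suc k) (suc l)
      c = B (suc k) zero
      r = B zero (suc l)

  1≉-1 : ¬ 1# ≈ - 1#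
  1≉-1 1≈-1 = 1+1≉0 (trans (+-congˡ 1≈-1) (-‿inverseʳ 1#))

  signs-unique : Unique signs
  signs-unique = (1≉-1 ∷ []) ∷ [] ∷ []

  signs-cancel : ∀ {s s′} → s ∈ signs → s′ ∈ signs → ¬ s ≈ s′ → s + s′ ≈ 0#
  signs-cancel (here s≈1)          (here s′≈1)          s≉s′ = contradiction (trans s≈1 (sym s′≈1)) s≉s′
  signs-cancel (here s≈1)          (there (here s′≈-1)) _    = trans (+-cong s≈1 s′≈-1) (-‿inverseʳ 1#)
  signs-cancel (there (here s≈-1)) (here s′≈1)          _    = trans (+-cong s≈-1 s′≈1) (-‿inverseˡ 1#)
  signs-cancel (there (here s≈-1)) (there (here s′≈-1)) s≉s′ = contradiction (trans s≈-1 (sym s′≈-1)) s≉s′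

  diag-cong : ∀ {n} {u v : Vector Carrier n} → u ≋ v → diag u ≈ᴹ diag v
  diag-cong u≋v i j = *-congʳ (u≋v i)

  diag-injective : ∀ {n} {u v : Vector Carrier n} → diag u ≈ᴹ diag v → u ≋ v
  diag-injective {u = u} {v} du≈dv i = begin
    u i               ≈⟨ *-identityʳ (u i) ⟨
    u i * 1#          ≡⟨ ≡.cong (u i *_) (1ᴹ-diag i) ⟨
    u i * 1ᴹ i i      ≈⟨ du≈dv i i ⟩
    v i * 1ᴹ i i      ≡⟨ ≡.cong (v i *_) (1ᴹ-diag i) ⟩
    v i * 1#          ≈⟨ *-identityʳ (v i) ⟩
    v i               ∎

length-cartesianProductWith : ∀ {a b c} {A : Set a} {B : Set b} {C : Set c} (f : A → B → C) xs ys →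
                              length (cartesianProductWith f xs ys) ≡ length xs ℕ.* length ys
length-cartesianProductWith f []       ys = ≡.refl
length-cartesianProductWith f (x ∷ xs) ys = ≡.trans (List.length-++ (map (f x) ys))
  (≡.cong₂ ℕ._+_ (List.length-map (f x) ys) (length-cartesianProductWith f xs ys))

module Vectors {a ℓ} (S : Setoid a ℓ) where
  open Setoid S
  open SetoidMembership S using (_∈_)
  open VectorEquality S using (_≋_; ≋-setoid)
  open SetoidUnique using (Unique)

  vectors : List Carrier → ∀ n → List (Vector Carrier n)
  vectors xs zero    = Vector.[] ∷ []
  vectors xs (suc n) = cartesianProductWith Vector._∷_ xs (vectors xs n)

  private
    _∈ᵥ_ : ∀ {n} → Vector Carrier n → List (Vector Carrier n) → Set _
    _∈ᵥ_ {n} = SetoidMembership._∈_ (≋-setoid n)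

    ∷-cong : ∀ {n x y} {u v : Vector Carrier n} → x ≈ y → u ≋ v → (x Vector.∷ u) ≋ (y Vector.∷ v)
    ∷-cong x≈y u≋v zero    = x≈y
    ∷-cong x≈y u≋v (suc i) = u≋v i

  length-vectors : ∀ xs n → length (vectors xs n) ≡ length xs ^ n
  length-vectors xs zero    = ≡.refl
  length-vectors xs (suc n) = ≡.trans (length-cartesianProductWith Vector._∷_ xs (vectors xs n))
                                      (≡.cong (length xs ℕ.*_) (length-vectors xs n))

  ∈-vectors⁺ : ∀ {xs n} {v : Vector Carrier n} → (∀ i → v i ∈ xs) → v ∈ᵥ vectors xs n
  ∈-vectors⁺ {n = zero}  v∈xs = here (λ ())
  ∈-vectors⁺ {n = suc n} v∈xs =
    Membership.∈-resp-≈ (≋-setoid (suc n)) (λ { zero → refl ; (suc i) → refl })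
      (Membership.∈-cartesianProductWith⁺ S (≋-setoid n) (≋-setoid (suc n)) ∷-cong
        (v∈xs zero) (∈-vectors⁺ (λ i → v∈xs (suc i))))

  ∈-vectors⁻ : ∀ {xs n} {v : Vector Carrier n} → v ∈ᵥ vectors xs n → ∀ i → v i ∈ xs
  ∈-vectors⁻ {xs} {suc n} v∈ i
    with x , u , x∈xs , u∈ , v≋x∷u ←
           Membership.∈-cartesianProductWith⁻ S (≋-setoid n) (≋-setoid (suc n)) Vector._∷_ xs (vectors xs n) v∈
    with i
  ... | zero  = Membership.∈-resp-≈ S (sym (v≋x∷u zero)) x∈xs
  ... | suc j = Membership.∈-resp-≈ S (sym (v≋x∷u (suc j))) (∈-vectors⁻ u∈ j)

  vectors⁺ : ∀ {xs} → Unique S xs → ∀ n → Unique (≋-setoid n) (vectors xs n)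
  vectors⁺ xs! zero    = [] ∷ []
  vectors⁺ xs! (suc n) = Unique.cartesianProductWith⁺ S (≋-setoid n) (≋-setoid (suc n)) Vector._∷_
    (λ e → e zero , λ i → e (suc i)) xs! (vectors⁺ xs! n)

module UniqueLists {c ℓ} (S : Setoid c ℓ) where
  open Setoid S
  open SetoidMembership S using (_∈_)
  open SetoidUnique S using (Unique)

  ∈-─⁺ : ∀ {x y xs} (x∈xs : x ∈ xs) → y ∈ xs → ¬ y ≈ x → y ∈ (xs ─ x∈xs)
  ∈-─⁺ (here x≈z)  (here y≈z)  y≉x = contradiction (trans y≈z (sym x≈z)) y≉x
  ∈-─⁺ (here _)    (there y∈)  _   = y∈
  ∈-─⁺ (there _)   (here y≈z)  _   = here y≈z
  ∈-─⁺ (there x∈)  (there y∈)  y≉x = there (∈-─⁺ x∈ y∈ y≉x)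

  length-mono-⊆ : ∀ {xs ys} → Unique xs → (∀ {x} → x ∈ xs → x ∈ ys) → length xs ≤ length ys
  length-mono-⊆ {[]}     _              _     = z≤n
  length-mono-⊆ {x ∷ xs} {ys} (x∉xs ∷ xs!) xs⊆ys =
    ≡.subst (suc (length xs) ≤_) (≡.sym (List.length-removeAt′ ys (Any.index x∈ys)))
      (s≤s (length-mono-⊆ xs! (λ y∈xs → ∈-─⁺ x∈ys (xs⊆ys (there y∈xs)) (y≉x y∈xs))))
    where
    x∈ys : x ∈ ys
    x∈ys = xs⊆ys (here refl)
    y≉x : ∀ {y} → y ∈ xs → ¬ y ≈ x
    y≉x y∈xs y≈x = Membership.All[≉]⇒∉ S x∉xs (Membership.∈-resp-≈ S y≈x y∈xs)

module MaximalIndependentSets {c ℓ a} (S : Setoid c ℓ) (Adj : Rel (Setoid.Carrier S) a)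
                              (_≟_ : Decidable (Setoid._≈_ S)) (Adj? : Decidable Adj)
                              (Adj-resp : Adj Respects₂ Setoid._≈_ S) where
  open Setoid S
  open SetoidMembership S using (_∈_; find; lose)
  open Graphs S Adj
  open UniqueLists S using (length-mono-⊆)

  Touches : Carrier → Carrier → Set _
  Touches v m = v ≈ m ⊎ Adj v m ⊎ Adj m v

  Dominates : List Carrier → Carrier → Set _
  Dominates M v = ∃ λ m → m ∈ M × Touches v m

  dominating⇒maximal : ∀ {M} → Independent M → (∀ v → Dominates M v) → MaximalIndependent M
  dominating⇒maximal {M} M-ind dom = M-ind , maximal
    where
    maximal : ∀ J → Independent J → M ⊆ˢ J → J ⊆ˢ M
    maximal J (_ , J-ind) M⊆J {y} y∈J with m , m∈M , touch ← dom y with y ≟ m | touch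
    ... | yes y≈m | _               = Membership.∈-resp-≈ S (sym y≈m) m∈M
    ... | no y≉m  | inj₁ y≈m        = contradiction y≈m y≉m
    ... | no y≉m  | inj₂ (inj₁ y~m) = contradiction y~m (J-ind y∈J (M⊆J m∈M) y≉m)
    ... | no y≉m  | inj₂ (inj₂ m~y) = contradiction m~y (J-ind (M⊆J m∈M) y∈J (y≉m ∘ sym))

  touches-resp : ∀ {v v′ m m′} → v ≈ v′ → m ≈ m′ → Touches v m → Touches v′ m′
  touches-resp v≈v′ m≈m′ (inj₁ v≈m)        = inj₁ (trans (sym v≈v′) (trans v≈m m≈m′))
  touches-resp v≈v′ m≈m′ (inj₂ (inj₁ v~m)) = inj₂ (inj₁ (proj₂ Adj-resp v≈v′ (proj₁ Adj-resp m≈m′ v~m)))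
  touches-resp v≈v′ m≈m′ (inj₂ (inj₂ m~v)) = inj₂ (inj₂ (proj₁ Adj-resp v≈v′ (proj₂ Adj-resp m≈m′ m~v)))

  dominates? : ∀ M v → Dec (Dominates M v)
  dominates? M v = map′ find (λ (m , m∈M , touch) → lose (touches-resp refl) m∈M touch)
                        (Any.any? (λ m → (v ≟ m) ⊎-dec (Adj? v m ⊎-dec Adj? m v)) M)

  ∷-independent : ∀ {v I} → Independent I → ¬ Dominates I v → Independent (v ∷ I)
  ∷-independent {v} {I} (I! , I-ind) ¬dom = (v∉I ∷ I!) , ind
    where
    v∉I : All (λ y → ¬ v ≈ y) I
    v∉I = tabulateₛ S (λ y∈I v≈y → ¬dom (_ , y∈I , inj₁ v≈y))
    ind : ∀ {x y} → x ∈ v ∷ I → y ∈ v ∷ I → ¬ x ≈ y → ¬ Adj x y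
    ind (here x≈v) (here y≈v) x≉y _   = x≉y (trans x≈v (sym y≈v))
    ind (here x≈v) (there y∈I) _  x~y = ¬dom (_ , y∈I , inj₂ (inj₁ (proj₂ Adj-resp x≈v x~y)))
    ind (there x∈I) (here y≈v) _  x~y = ¬dom (_ , x∈I , inj₂ (inj₂ (proj₁ Adj-resp y≈v x~y)))
    ind (there x∈I) (there y∈I)       = I-ind x∈I y∈I

  extend : ∀ vs I → Independent I →
           ∃ λ M → Independent M × I ⊆ˢ M × (∀ {v} → v ∈ vs → Dominates M v)
  extend []       I I-ind = I , I-ind , (λ x∈I → x∈I) , λ ()
  extend (v ∷ vs) I I-ind with dominates? I v
  ... | yes (m , m∈I , touch) =
    let M , M-ind , I⊆M , dom = extend vs I I-ind
    in  M , M-ind , I⊆M , λ { (here w≈v) → m , I⊆M m∈I , touches-resp (sym w≈v) refl touch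
                            ; (there w∈vs) → dom w∈vs }
  ... | no ¬dom =
    let M , M-ind , I′⊆M , dom = extend vs (v ∷ I) (∷-independent I-ind ¬dom)
    in  M , M-ind , (λ x∈I → I′⊆M (there x∈I)) , λ { (here w≈v) → v , I′⊆M (here refl) , inj₁ w≈v
                                                    ; (there w∈vs) → dom w∈vs }

  extend-maximal : ∀ vs → (∀ v → v ∈ vs) → ∀ I → Independent I →
                   ∃ λ M → MaximalIndependent M × length I ≤ length M
  extend-maximal vs vs-complete I I-ind =
    let M , M-ind , I⊆M , dom = extend vs I I-ind
    in  M , dominating⇒maximal M-ind (λ v → dom (vs-complete v)) , length-mono-⊆ (proj₁ I-ind) I⊆M

finite⇒¬¬decidable : ∀ {c ℓ} (S : Setoid c ℓ) → Finite S → ¬ ¬ Decidable (Setoid._≈_ S)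
finite⇒¬¬decidable S (xs , complete) =
  ¬¬-map decide (¬¬-all (λ x → ¬¬-all (λ y → ¬¬-excluded-middle) xs) xs)
  where
  open Setoid S
  ¬¬-all : ∀ {p} {P : Carrier → Set p} → (∀ x → ¬ ¬ P x) → ∀ ys → ¬ ¬ All P ys
  ¬¬-all ¬¬P []       ¬all = ¬all []
  ¬¬-all ¬¬P (y ∷ ys) ¬all = ¬¬P y (λ py → ¬¬-all ¬¬P ys (λ pys → ¬all (py ∷ pys)))
  decide : All (λ x → All (λ y → Dec (x ≈ y)) xs) xs → Decidable _≈_
  decide table x y =
    let row  , x≈x′ = lookupAny table (complete x)
        x′≟y′ , y≈y′ = lookupAny row (complete y)
    in  map′ (λ x′≈y′ → trans x≈x′ (trans x′≈y′ (sym y≈y′)))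
             (λ x≈y → trans (sym x≈x′) (trans x≈y y≈y′)) x′≟y′

module UnitGraphOfMatrices {ℓ₁ ℓ₂} (F : Field ℓ₁ ℓ₂) (xs : List (Field.Carrier F))
                           (complete : ∀ x → SetoidMembership._∈_ (Field.setoid F) x xs)
                           (_≟_ : Decidable (Field._≈_ F)) (1+1≉0 : CharNot2 F) where
  open Field F hiding (zero)
  open MatrixRing ring
  open MatrixAlgebra commutativeRing
  open SignDiagonals F _≟_ 1+1≉0
  open import Algebra.Properties.Ring ring using (-‿involutive; -0#≈0#)
  open VectorEquality setoid using (≋-setoid)
  open SetoidMembership setoid using (_∈_)
  open SetoidUnique setoid using (Unique)

  module _ (n : ℕ) where
    open SetoidMembership (matrixSetoid n) using (find; lose) renaming (_∈_ to _∈ᴹ_)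
    open Graphs (matrixSetoid n) (UnitGraphAdj F n)

    matrices : List (Matrix n)
    matrices = Vectors.vectors (≋-setoid n) (Vectors.vectors setoid xs n) n

    matrices-complete : ∀ A → A ∈ᴹ matrices
    matrices-complete A =
      Vectors.∈-vectors⁺ (≋-setoid n) (λ i → Vectors.∈-vectors⁺ setoid (λ j → complete (A i j)))

    _≟ᴹ_ : Decidable (_≈ᴹ_ {n})
    A ≟ᴹ B = Fin.all? (λ i → Fin.all? (λ j → A i j ≟ B i j))

    IsUnitᴹ? : ∀ A → Dec (IsUnitᴹ A)
    IsUnitᴹ? A = map′ (λ inverse∈ → let B , _ , inv = find inverse∈ in B , inv)
                      (λ (B , inv) → lose inverse-resp (matrices-complete B) inv)
                      (Any.any? (λ B → ((A *ᴹ B) ≟ᴹ 1ᴹ) ×-dec ((B *ᴹ A) ≟ᴹ 1ᴹ)) matrices)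

    Adj? : Decidable (UnitGraphAdj F n)
    Adj? A B = IsUnitᴹ? (A +ᴹ B)

    Adj-resp : UnitGraphAdj F n Respects₂ _≈ᴹ_
    Adj-resp = (λ B≈B′ → IsUnitᴹ-resp (λ i j → +-congˡ (B≈B′ i j)))
             , (λ A≈A′ → IsUnitᴹ-resp (λ i j → +-congʳ (A≈A′ i j)))

    open MaximalIndependentSets (matrixSetoid n) (UnitGraphAdj F n) _≟ᴹ_ Adj? Adj-resp public

    signDiagonals : List (Matrix n)
    signDiagonals = map diag (Vectors.vectors setoid signs n)

    length-signDiagonals : length signDiagonals ≡ 2 ^ n
    length-signDiagonals = ≡.trans (List.length-map diag (Vectors.vectors setoid signs n))
                                   (Vectors.length-vectors setoid signs n)

    ∈-signDiagonals⁻ : ∀ {A} → A ∈ᴹ signDiagonals → ∃ λ v → (∀ i → v i ∈ signs) × A ≈ᴹ diag v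
    ∈-signDiagonals⁻ A∈ =
      let v , v∈ , A≈dv = Membership.∈-map⁻ (≋-setoid n) (matrixSetoid n) A∈
      in  v , Vectors.∈-vectors⁻ setoid v∈ , A≈dv

    signDiagonals-independent : Independent signDiagonals
    signDiagonals-independent =
      Unique.map⁺ (≋-setoid n) (matrixSetoid n) diag-injective (Vectors.vectors⁺ setoid signs-unique n)
      , independent
      where
      open SetoidReasoning setoid
      independent : ∀ {A B} → A ∈ᴹ signDiagonals → B ∈ᴹ signDiagonals → ¬ A ≈ᴹ B → ¬ IsUnitᴹ (A +ᴹ B)
      independent {A} {B} A∈ B∈ A≉B
        with u , u∈ , A≈du ← ∈-signDiagonals⁻ A∈ | v , v∈ , B≈dv ← ∈-signDiagonals⁻ B∈
        with Fin.all? (λ i → u i ≟ v i)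
      ... | yes u≋v = contradiction (≈ᴹ.trans A≈du (≈ᴹ.trans (diag-cong u≋v) (≈ᴹ.sym B≈dv))) A≉B
      ... | no u≉v with i , uᵢ≉vᵢ ← Fin.¬∀⟶∃¬ n _ (λ i → u i ≟ v i) u≉v =
        zeroRow⇒¬IsUnitᴹ 1≉0 (A +ᴹ B) i λ j → begin
          A i j + B i j                ≈⟨ +-cong (A≈du i j) (B≈dv i j) ⟩
          u i * 1ᴹ i j + v i * 1ᴹ i j  ≈⟨ distribʳ _ _ _ ⟨
          (u i + v i) * 1ᴹ i j         ≈⟨ *-congʳ (signs-cancel (u∈ i) (v∈ i) uᵢ≉vᵢ) ⟩
          0# * 1ᴹ i j                  ≈⟨ zeroˡ _ ⟩
          0#                           ∎

    signDiagonals-maximal : MaximalIndependent signDiagonals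
    signDiagonals-maximal = dominating⇒maximal signDiagonals-independent dominated
      where
      dominated : ∀ B → Dominates signDiagonals B
      dominated B =
        let v , v∈ , unit = IsUnitᴹ-diag+ B
        in  diag v , Membership.∈-map⁺ (≋-setoid n) (matrixSetoid n) diag-cong (Vectors.∈-vectors⁺ setoid v∈)
                   , inj₂ (inj₂ unit)

  digits : List Carrier
  digits = 0# ∷ 1# ∷ - 1# ∷ []

  digits-unique : Unique digits
  digits-unique = (0≉1 ∷ 0≉-1 ∷ []) ∷ (1≉-1 ∷ []) ∷ [] ∷ []
    where
    open SetoidReasoning setoid
    0≉1 : ¬ 0# ≈ 1#
    0≉1 0≈1 = 1≉0 (sym 0≈1)
    0≉-1 : ¬ 0# ≈ - 1#
    0≉-1 0≈-1 = 1≉0 (begin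
      1#       ≈⟨ -‿involutive 1# ⟨
      - - 1#   ≈⟨ -‿cong 0≈-1 ⟨
      - 0#     ≈⟨ -0#≈0# ⟩
      0#       ∎)

  zeroTop : ∀ {n} → Vector Carrier (suc n) → Matrix (suc n)
  zeroTop v zero    j = 0#
  zeroTop v (suc i) j = v j

  module _ (m : ℕ) where
    private
      n : ℕ
      n = suc (suc m)
    open SetoidMembership (matrixSetoid n) using () renaming (_∈_ to _∈ᴹ_)
    open Graphs (matrixSetoid n) (UnitGraphAdj F n)

    zeroTopMatrices : List (Matrix n)
    zeroTopMatrices = map zeroTop (Vectors.vectors setoid digits n)

    length-zeroTopMatrices : length zeroTopMatrices ≡ 3 ^ n
    length-zeroTopMatrices = ≡.trans (List.length-map zeroTop (Vectors.vectors setoid digits n))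
                                     (Vectors.length-vectors setoid digits n)

    zeroTopMatrices-independent : Independent zeroTopMatrices
    zeroTopMatrices-independent =
      Unique.map⁺ (≋-setoid n) (matrixSetoid n) (λ e → e (suc zero)) (Vectors.vectors⁺ setoid digits-unique n)
      , independent
      where
      independent : ∀ {A B} → A ∈ᴹ zeroTopMatrices → B ∈ᴹ zeroTopMatrices → ¬ A ≈ᴹ B → ¬ IsUnitᴹ (A +ᴹ B)
      independent {A} {B} A∈ B∈ _
        with _ , _ , A≈ ← Membership.∈-map⁻ (≋-setoid n) (matrixSetoid n) A∈
           | _ , _ , B≈ ← Membership.∈-map⁻ (≋-setoid n) (matrixSetoid n) B∈ =
        zeroRow⇒¬IsUnitᴹ 1≉0 (A +ᴹ B) zero (λ j → trans (+-cong (A≈ zero j) (B≈ zero j)) (+-identityʳ 0#))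

  0ᴹ : ∀ {n} → Matrix n
  0ᴹ _ _ = 0#

  [0ᴹ]-maximal : Graphs.MaximalIndependent (matrixSetoid 1) (UnitGraphAdj F 1) (0ᴹ ∷ [])
  [0ᴹ]-maximal = dominating⇒maximal 1 (([] ∷ []) , independent) dominated
    where
    open SetoidMembership (matrixSetoid 1) using () renaming (_∈_ to _∈ᴹ_)
    independent : ∀ {A B} → A ∈ᴹ 0ᴹ ∷ [] → B ∈ᴹ 0ᴹ ∷ [] → ¬ A ≈ᴹ B → ¬ IsUnitᴹ (A +ᴹ B)
    independent (here A≈0) (here B≈0) A≉B = contradiction (≈ᴹ.trans A≈0 (≈ᴹ.sym B≈0)) A≉B
    dominated : ∀ B → Dominates 1 (0ᴹ ∷ []) B
    dominated B with B zero zero ≟ 0#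
    ... | yes b≈0 = 0ᴹ , here ≈ᴹ.refl , inj₁ (λ { zero zero → b≈0 })
    ... | no b≉0 with b′ , bb′≈1 ← inverse (B zero zero) b≉0 =
      0ᴹ , here ≈ᴹ.refl , inj₂ (inj₂ ((λ _ _ → b′) , (λ { zero zero → Bb′≈1 }) , (λ { zero zero → b′B≈1 })))
      where
      Bb′≈1 : (0# + B zero zero) * b′ + 0# ≈ 1#
      Bb′≈1 = trans (+-identityʳ _) (trans (*-congʳ (+-identityˡ _)) bb′≈1)
      b′B≈1 : b′ * (0# + B zero zero) + 0# ≈ 1#
      b′B≈1 = trans (+-identityʳ _) (trans (*-congˡ (+-identityˡ _)) (trans (*-comm _ _) bb′≈1))

  not-wellCovered : ∀ n → 1 ≤ n → ¬ UnitGraphMatWellCovered F n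
  not-wellCovered (suc zero) _ wellCovered
    with () ← wellCovered _ _ [0ᴹ]-maximal (signDiagonals-maximal 1)
  not-wellCovered (suc (suc m)) _ wellCovered =
    let M , M-maximal , 3ⁿ≤|M| = extend-maximal n (matrices n) (matrices-complete n)
                                   (zeroTopMatrices m) (zeroTopMatrices-independent m)
    in  ℕ.<⇒≱ (ℕ.^-monoˡ-< n (s≤s (s≤s (s≤s z≤n)))) (begin
          3 ^ n                       ≡⟨ length-zeroTopMatrices m ⟨
          length (zeroTopMatrices m)  ≤⟨ 3ⁿ≤|M| ⟩
          length M                    ≡⟨ wellCovered _ _ (signDiagonals-maximal n) M-maximal ⟨
          length (signDiagonals n)    ≡⟨ length-signDiagonals n ⟩
          2 ^ n                       ∎)
    where
    open ℕ.≤-Reasoning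
    n : ℕ
    n = suc (suc m)

corollary2p4 : ∀ {c ℓ : Level} (F : Field c ℓ) → FiniteField F → (n : ℕ) → 1 ≤ n →
    CharNot2 F → ¬ UnitGraphMatWellCovered F n
corollary2p4 F (xs , complete) n 1≤n 1+1≉0 wellCovered =
  finite⇒¬¬decidable (Field.setoid F) (xs , complete) λ _≟_ →
    UnitGraphOfMatrices.not-wellCovered F xs complete _≟_ 1+1≉0 n 1≤n wellCovered
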